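{- Assume $n\to\infty$ and $m=m(n)$ with $\alpha=m/n\in[0.5\log n,\log n]$. Then, uniformly over all choices of $a_1,\dots,a_\nu$ with $0\le a_i\le i-1$, \[ \frac{|\mathcal Y_3|}{|\mathcal Y_1|}=1-O(n^{ -1}). \]
   Context: Let $\nu=\lceil 2(\alpha+1)\log n\rceil$, let $a_1,\dots,a_\nu$ be integers with $0\le a_i\le i-1$, and $a=a_1+\dots+a_\nu$. Define $\mathcal Y_1$ as the set of sequences $(y_1,\dots,y_{n-\nu})$ of nonnegative integers with $\sum_{i}y_i=m-a$, and $\mathcal Y_3$ as the subset of $\mathcal Y_1$ consisting of those sequences with $y_i\le \nu-1$ for all $i$. -}

module Defs where

open import Data.Nat using (ℕ; zero; suc; _+_; _*_; _∸_; _^_; _≤_; _<_)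
open import Data.Vec using (Vec; sum)
open import Data.Vec.Relation.Unary.All using (All)
open import Data.Product using (Σ; _×_)
open import Data.Sum using (_⊎_)
open import Relation.Binary.PropositionalEquality using (_≡_)
open import Relation.Nullary using (¬_)

-- No real numbers are available, so comparisons between e^p (p : ℕ) and a
-- natural number N are defined via the monotone rational sequences
--   (1 + p/k)^k  ↑ e^p      and      (1 - p/k)^(-k)  ↓ e^p   (k > p).
-- N ≤ e^p  iff  N ≤ (1 - p/k)^(-k) for all k > p, i.e. N (k-p)^k ≤ k^k.
N≤exp : ℕ → ℕ → Set
N≤exp N p = ∀ k → p < k → N * (k ∸ p) ^ k ≤ k ^ k

-- e^p ≤ N  iff  (1 + p/k)^k ≤ N for all k ≥ 1, i.e. (k+p)^k ≤ N k^k
-- (for k = 0 the condition reads 1 ≤ N, which is implied anyway).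
exp≤N : ℕ → ℕ → Set
exp≤N p N = ∀ k → (k + p) ^ k ≤ N * k ^ k

-- α = m/n ∈ [0.5 log n, log n]  ⇔  n log n ≤ 2m  and  m ≤ n log n
--                                 ⇔  n^n ≤ e^(2m)  and  e^m ≤ n^n.
AlphaRange : ℕ → ℕ → Set
AlphaRange n m = N≤exp (n ^ n) (2 * m) × exp≤N m (n ^ n)

-- ν = ⌈ 2 (α+1) log n ⌉ with α = m/n: ν is the least natural number with
-- ν ≥ 2 (m+n) log n / n, i.e. with n^(2(m+n)) ≤ e^(n ν).
IsNu : ℕ → ℕ → ℕ → Set
IsNu n m zero    = N≤exp (n ^ (2 * (m + n))) 0
IsNu n m (suc ν) = N≤exp (n ^ (2 * (m + n))) (n * suc ν)
                 × ¬ N≤exp (n ^ (2 * (m + n))) (n * ν)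

-- 𝒴₁ : sequences (y₁,…,y_{n-ν}) of nonnegative integers with Σ yᵢ = m - a
-- (written Σ yᵢ + a = m to avoid truncated subtraction).
𝒴₁ : (n ν m a : ℕ) → Set
𝒴₁ n ν m a = Σ (Vec ℕ (n ∸ ν)) (λ y → sum y + a ≡ m)

𝒴₃ : (n ν m a : ℕ) → Set
𝒴₃ n ν m a = Σ (Vec ℕ (n ∸ ν)) (λ y → (sum y + a ≡ m) × All (_< ν) y)

{-# OPTIONS --safe #-}
-- With L = n - ν and M = m - a, the sequences in 𝒴₁ are the compositions of M into L parts,
-- counted by (L + M - 1 choose M). A sequence outside 𝒴₃ is determined by the position of its
-- first entry ≥ ν and the composition of M - ν left after lowering that entry by ν, so
-- |𝒴₁| - |𝒴₃| ≤ L (L + M - ν - 1 choose M - ν). Each unit increase of M multiplies the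
-- binomial by at least (m + L - 1)/m, so (|𝒴₁| - |𝒴₃|)/|𝒴₁| ≤ L (m/(m + L - 1))^ν, and
-- ν ≥ 2 (α + 1) log n makes (1 + (L - 1)/m)^ν ≥ n²/2. The exponential function only enters
-- through the comparisons N≤exp and exp≤N, which are traded for powers of 2 via ℓ ≈ log₂ n.
module Submission where

open import Defs
open import Data.Nat using (ℕ; _+_; _*_; _≤_; _<_; ∣_-_∣)
open import Data.Fin using (Fin; toℕ)
open import Data.Vec using (Vec; sum; lookup)
open import Data.Product using (Σ; _×_)
open import Function.Bundles using (_↔_)

open import Data.Nat
open import Data.Nat.Properties
open import Algebra.Properties.CommutativeSemigroup *-commutativeSemigroup using (interchange; x∙yz≈y∙xz)
open import Data.Nat.Tactic.RingSolver using (solve-∀)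
open import Data.Fin using (zero; suc)
import Data.Fin.Properties as Fin
open import Data.Vec using ([]; _∷_; updateAt)
open import Data.Vec.Relation.Unary.All as All using (All; []; _∷_; all?)
open import Data.Product using (_,_; proj₁; proj₂)
open import Data.Product.Function.NonDependent.Propositional using (_×-↣_)
open import Data.Sum using (_⊎_; inj₁; inj₂)
open import Data.Sum.Function.Propositional using (_⊎-↣_; _⊎-↔_)
open import Function using (_∘_)
open import Function.Bundles using (_↣_; mk↔ₛ′; mk↣; Injection)
open import Function.Construct.Composition using (_↔-∘_; _↣-∘_)
open import Function.Construct.Identity using (↣-id)
open import Function.Construct.Symmetry using (↔-sym)
open import Function.Properties.Inverse using (↔⇒↣)
open import Relation.Binary.PropositionalEquality
open import Relation.Nullary using (¬_; yes; no; contradiction)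

^-distribʳ-* : ∀ m n o → (m * n) ^ o ≡ m ^ o * n ^ o
^-distribʳ-* m n zero    = refl
^-distribʳ-* m n (suc o) = begin
  m * n * (m * n) ^ o      ≡⟨ cong (m * n *_) (^-distribʳ-* m n o) ⟩
  m * n * (m ^ o * n ^ o)  ≡⟨ interchange m n (m ^ o) (n ^ o) ⟩
  m * m ^ o * (n * n ^ o)  ∎
  where open ≡-Reasoning

^-cancelʳ-≤ : ∀ k .{{_ : NonZero k}} {a b} → a ^ k ≤ b ^ k → a ≤ b
^-cancelʳ-≤ k {a} {b} aᵏ≤bᵏ with a ≤? b
... | yes a≤b = a≤b
... | no  a≰b = contradiction aᵏ≤bᵏ (<⇒≱ (^-monoˡ-< k (≰⇒> a≰b)))

^-cancelˡ-≤ : ∀ {m a b} → 1 < m → m ^ a ≤ m ^ b → a ≤ b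
^-cancelˡ-≤ {m} {a} {b} 1<m mᵃ≤mᵇ with a ≤? b
... | yes a≤b = a≤b
... | no  a≰b = contradiction mᵃ≤mᵇ (<⇒≱ (^-monoʳ-< m 1<m (≰⇒> a≰b)))

^-cancelˡ-< : ∀ m .{{_ : NonZero m}} {a b} → m ^ a < m ^ b → a < b
^-cancelˡ-< m {a} {b} mᵃ<mᵇ with a <? b
... | yes a<b = a<b
... | no  a≮b = contradiction mᵃ<mᵇ (≤⇒≯ (^-monoʳ-≤ m (≮⇒≥ a≮b)))

n^n≤k^k⇒n≤k : ∀ {n k} .{{_ : NonZero k}} → n ^ n ≤ k ^ k → n ≤ k
n^n≤k^k⇒n≤k {n} {k} nⁿ≤kᵏ with n ≤? k
... | yes n≤k = n≤k
... | no  n≰k = contradiction nⁿ≤kᵏ (<⇒≱ (begin-strict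
  k ^ k  <⟨ ^-monoˡ-< k k<n ⟩
  n ^ k  ≤⟨ ^-monoʳ-≤ n {{>-nonZero (<-≤-trans (>-nonZero⁻¹ k) (<⇒≤ k<n))}} (<⇒≤ k<n) ⟩
  n ^ n  ∎))
  where
  open ≤-Reasoning
  k<n = ≰⇒> n≰k

n^n>0 : ∀ n → 0 < n ^ n
n^n>0 zero    = s≤s z≤n
n^n>0 (suc n) = m^n>0 (suc n) (suc n)

m∸n≡1+[m∸1+n] : ∀ {m n} → suc n ≤ m → m ∸ n ≡ suc (m ∸ suc n)
m∸n≡1+[m∸1+n] {m} {n} 1+n≤m = begin
  m ∸ n                    ≡⟨ cong (_∸ n) (m∸n+n≡m 1+n≤m) ⟨
  m ∸ suc n + suc n ∸ n    ≡⟨ cong (_∸ n) (+-suc (m ∸ suc n) n) ⟩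
  suc (m ∸ suc n) + n ∸ n  ≡⟨ m+n∸n≡m (suc (m ∸ suc n)) n ⟩
  suc (m ∸ suc n)          ∎
  where open ≡-Reasoning

-- Bernoulli's inequality (1 + 1/t)^s ≥ 1 + s/t, cleared of denominators.
bernoulli : ∀ t s → t ^ s * (t + s) ≤ suc t ^ s * t
bernoulli t zero    = ≤-reflexive (+-identityʳ (t + 0))
bernoulli t (suc s) = begin
  t * t ^ s * (t + suc s)                ≤⟨ m≤m+n _ _ ⟩
  t * t ^ s * (t + suc s) + t ^ s * s    ≡⟨ regroup t (t ^ s) s ⟩
  suc t * (t ^ s * (t + s))              ≤⟨ *-monoʳ-≤ (suc t) (bernoulli t s) ⟩
  suc t * (suc t ^ s * t)                ≡⟨ *-assoc (suc t) (suc t ^ s) t ⟨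
  suc t * suc t ^ s * t                  ∎
  where
  open ≤-Reasoning
  regroup : ∀ t x s → t * x * (t + suc s) + x * s ≡ suc t * (x * (t + s))
  regroup = solve-∀

2*n^n≤[1+n]^n : ∀ n .{{_ : NonZero n}} → 2 * n ^ n ≤ suc n ^ n
2*n^n≤[1+n]^n n = *-cancelʳ-≤ (2 * n ^ n) (suc n ^ n) n (begin
  2 * n ^ n * n  ≡⟨ regroup n (n ^ n) ⟩
  n ^ n * (n + n)  ≤⟨ bernoulli n n ⟩
  suc n ^ n * n  ∎)
  where
  open ≤-Reasoning
  regroup : ∀ n x → 2 * x * n ≡ x * (n + n)
  regroup = solve-∀

-- (1 + p/j)^(j+p) ≥ 2^p, by p doublings of the form (1 + 1/t)^t ≥ 2.
2^p*j^[j+p]≤[j+p]^[j+p] : ∀ j p .{{_ : NonZero j}} → 2 ^ p * j ^ (j + p) ≤ (j + p) ^ (j + p)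
2^p*j^[j+p]≤[j+p]^[j+p] j zero    rewrite +-identityʳ j = ≤-reflexive (*-identityˡ (j ^ j))
2^p*j^[j+p]≤[j+p]^[j+p] j (suc p) rewrite +-suc j p = begin
  2 * 2 ^ p * (j * j ^ (j + p))      ≡⟨ regroup (2 ^ p) j (j ^ (j + p)) ⟩
  2 * (2 ^ p * j ^ (j + p)) * j      ≤⟨ *-mono-≤ (*-monoʳ-≤ 2 (2^p*j^[j+p]≤[j+p]^[j+p] j p)) j≤1+j+p ⟩
  2 * t ^ t * suc t                  ≤⟨ *-monoˡ-≤ (suc t) (2*n^n≤[1+n]^n t {{t≢0}}) ⟩
  suc t ^ t * suc t                  ≡⟨ *-comm (suc t ^ t) (suc t) ⟩
  suc t ^ suc t                      ∎
  where
  open ≤-Reasoning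
  t = j + p
  t≢0 : NonZero t
  t≢0 = >-nonZero (<-≤-trans (>-nonZero⁻¹ j) (m≤m+n j p))
  j≤1+j+p : j ≤ suc t
  j≤1+j+p = ≤-trans (m≤m+n j p) (n≤1+n t)
  regroup : ∀ P j J → 2 * P * (j * J) ≡ 2 * (P * J) * j
  regroup = solve-∀

-- Comparisons with the exponential function

≤2^⇒N≤exp : ∀ {X p} → X ≤ 2 ^ p → N≤exp X p
≤2^⇒N≤exp {X} {p} X≤2ᵖ k p<k = begin
  X * (k ∸ p) ^ k                     ≤⟨ *-monoˡ-≤ _ X≤2ᵖ ⟩
  2 ^ p * (k ∸ p) ^ k                 ≡⟨ cong (λ u → 2 ^ p * (k ∸ p) ^ u) k≡[k∸p]+p ⟩
  2 ^ p * (k ∸ p) ^ (k ∸ p + p)       ≤⟨ 2^p*j^[j+p]≤[j+p]^[j+p] (k ∸ p) p {{>-nonZero (m<n⇒0<n∸m p<k)}} ⟩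
  (k ∸ p + p) ^ (k ∸ p + p)           ≡⟨ cong (λ u → u ^ u) k≡[k∸p]+p ⟨
  k ^ k                               ∎
  where
  open ≤-Reasoning
  k≡[k∸p]+p : k ≡ k ∸ p + p
  k≡[k∸p]+p = sym (m∸n+n≡m (<⇒≤ p<k))

¬N≤exp⇒2^< : ∀ {X p} → ¬ N≤exp X p → 2 ^ p < X
¬N≤exp⇒2^< {X} {p} ¬X≤eᵖ with X ≤? 2 ^ p
... | yes X≤2ᵖ = contradiction (≤2^⇒N≤exp X≤2ᵖ) ¬X≤eᵖ
... | no  X≰2ᵖ = ≰⇒> X≰2ᵖ

N≤exp⇒≤[1+p]^[1+p] : ∀ {X p} → N≤exp X p → X ≤ suc p ^ suc p
N≤exp⇒≤[1+p]^[1+p] {X} {p} X≤eᵖ = begin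
  X                          ≡⟨ *-identityʳ X ⟨
  X * 1                      ≡⟨ cong (X *_) (^-zeroˡ (suc p)) ⟨
  X * 1 ^ suc p              ≡⟨ cong (λ u → X * u ^ suc p) (m+n∸n≡m 1 p) ⟨
  X * (suc p ∸ p) ^ suc p    ≤⟨ X≤eᵖ (suc p) (n<1+n p) ⟩
  suc p ^ suc p              ∎
  where open ≤-Reasoning

exp≤N⇒2^≤ : ∀ {p N} → exp≤N p N → 2 ^ p ≤ N
exp≤N⇒2^≤ {p} {N} eᵖ≤N = *-cancelʳ-≤ (2 ^ p) N (p ^ p) {{>-nonZero (n^n>0 p)}} (begin
  2 ^ p * p ^ p   ≡⟨ ^-distribʳ-* 2 p p ⟨
  (2 * p) ^ p     ≡⟨ cong (_^ p) (cong (p +_) (+-identityʳ p)) ⟩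
  (p + p) ^ p     ≤⟨ eᵖ≤N p ⟩
  N * p ^ p       ∎)
  where open ≤-Reasoning

N≤exp-scale : ∀ {X p q m P} → N≤exp X p → 0 < q → (p + q) * m ≤ q * P →
              X * m ^ (p + q) ≤ P ^ (p + q)
N≤exp-scale {X} {p} {q} {m} {P} X≤eᵖ q>0 km≤qP =
  *-cancelʳ-≤ (X * m ^ k) (P ^ k) (q ^ k) {{>-nonZero (m^n>0 q {{>-nonZero q>0}} k)}} (begin
    X * m ^ k * q ^ k   ≡⟨ swap X (m ^ k) (q ^ k) ⟩
    X * q ^ k * m ^ k   ≤⟨ *-monoˡ-≤ (m ^ k) X*qᵏ≤kᵏ ⟩
    k ^ k * m ^ k       ≡⟨ ^-distribʳ-* k m k ⟨
    (k * m) ^ k         ≤⟨ ^-monoˡ-≤ k km≤qP ⟩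
    (q * P) ^ k         ≡⟨ ^-distribʳ-* q P k ⟩
    q ^ k * P ^ k       ≡⟨ *-comm (q ^ k) (P ^ k) ⟩
    P ^ k * q ^ k       ∎)
  where
  open ≤-Reasoning
  k = p + q
  X*qᵏ≤kᵏ : X * q ^ k ≤ k ^ k
  X*qᵏ≤kᵏ = subst (λ u → X * u ^ k ≤ k ^ k) (m+n∸m≡n p q) (X≤eᵖ k (m<m+n p q>0))
  swap : ∀ a b c → a * b * c ≡ a * c * b
  swap = solve-∀

-- Compositions

Compositions : ℕ → ℕ → Set
Compositions L M = Σ (Vec ℕ L) λ y → sum y ≡ M

-- compositions (suc D) M is the binomial coefficient (D + M) choose M.
compositions : ℕ → ℕ → ℕ
compositions zero    zero    = 1
compositions zero    (suc M) = 0
compositions (suc L) zero    = compositions L zero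
compositions (suc L) (suc M) = compositions (suc L) M + compositions L (suc M)

Σ-≡ : ∀ {A : Set} {P : A → Set} → (∀ {x} (p q : P x) → p ≡ q) →
      {u v : Σ A P} → proj₁ u ≡ proj₁ v → u ≡ v
Σ-≡ irrelevant {x , p} {.x , q} refl = cong (x ,_) (irrelevant p q)

Compositions-≡ : ∀ {L M} {u v : Compositions L M} → proj₁ u ≡ proj₁ v → u ≡ v
Compositions-≡ = Σ-≡ ≡-irrelevant

Compositions↔Fin : ∀ L M → Compositions L M ↔ Fin (compositions L M)
Compositions↔Fin zero    zero    = mk↔ₛ′ (λ _ → zero) (λ _ → [] , refl)
  (λ { zero → refl }) (λ { ([] , refl) → refl })
Compositions↔Fin zero    (suc M) = mk↔ₛ′ (λ { ([] , ()) }) (λ ()) (λ ()) (λ { ([] , ()) })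
Compositions↔Fin (suc L) zero    = Compositions↔Fin L zero ↔-∘ headless
  where
  headless : Compositions (suc L) zero ↔ Compositions L zero
  headless = mk↔ₛ′ (λ { (zero ∷ y , s) → y , s ; (suc _ ∷ _ , ()) }) (λ { (y , s) → zero ∷ y , s })
    (λ _ → Compositions-≡ refl) (λ { (zero ∷ y , s) → Compositions-≡ refl ; (suc _ ∷ _ , ()) })
Compositions↔Fin (suc L) (suc M) =
  ↔-sym Fin.+↔⊎ ↔-∘ ((Compositions↔Fin (suc L) M ⊎-↔ Compositions↔Fin L (suc M)) ↔-∘ split)
  where
  to : Compositions (suc L) (suc M) → Compositions (suc L) M ⊎ Compositions L (suc M)
  to (zero  ∷ y , s) = inj₂ (y , s)
  to (suc x ∷ y , s) = inj₁ (x ∷ y , suc-injective s)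
  from : Compositions (suc L) M ⊎ Compositions L (suc M) → Compositions (suc L) (suc M)
  from (inj₁ (x ∷ y , s)) = suc x ∷ y , cong suc s
  from (inj₂ (y , s))     = zero ∷ y , s
  split : Compositions (suc L) (suc M) ↔ (Compositions (suc L) M ⊎ Compositions L (suc M))
  split = mk↔ₛ′ to from
    (λ { (inj₁ (x ∷ y , s)) → cong inj₁ (Compositions-≡ refl) ; (inj₂ _) → cong inj₂ (Compositions-≡ refl) })
    (λ { (zero ∷ y , s) → Compositions-≡ refl ; (suc x ∷ y , s) → Compositions-≡ refl })

compositions-zeroʳ : ∀ L → compositions L 0 ≡ 1
compositions-zeroʳ zero    = refl
compositions-zeroʳ (suc L) = compositions-zeroʳ L

compositions-oneˡ : ∀ M → compositions 1 M ≡ 1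
compositions-oneˡ zero    = refl
compositions-oneˡ (suc M) = trans (+-identityʳ _) (compositions-oneˡ M)

compositions>0 : ∀ D M → 0 < compositions (suc D) M
compositions>0 D zero    = ≤-reflexive (sym (compositions-zeroʳ D))
compositions>0 D (suc M) = ≤-trans (compositions>0 D M) (m≤m+n _ _)

compositions*!≡! : ∀ D M → compositions (suc D) M * (D ! * M !) ≡ (D + M) !
compositions*!≡! zero M = begin
  compositions 1 M * (1 * M !)  ≡⟨ cong (_* (1 * M !)) (compositions-oneˡ M) ⟩
  1 * (1 * M !)                 ≡⟨ *-identityˡ (M ! + 0) ⟩
  M ! + 0                       ≡⟨ +-identityʳ (M !) ⟩
  M !                           ∎
  where open ≡-Reasoning
compositions*!≡! (suc D) zero = begin
  compositions (suc (suc D)) 0 * (suc D ! * 1)  ≡⟨ cong (_* (suc D ! * 1)) (compositions-zeroʳ (suc (suc D))) ⟩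
  1 * (suc D ! * 1)                             ≡⟨ *-identityˡ (suc D ! * 1) ⟩
  suc D ! * 1                                   ≡⟨ *-identityʳ (suc D !) ⟩
  suc D !                                       ≡⟨ cong _! (+-identityʳ (suc D)) ⟨
  (suc D + 0) !                                 ∎
  where open ≡-Reasoning
compositions*!≡! (suc D) (suc M) = begin
  (a + b) * (suc D ! * suc M !)
    ≡⟨ expand a b D (D !) M (M !) ⟩
  suc M * (a * (suc D ! * M !)) + suc D * (b * (D ! * suc M !))
    ≡⟨ cong₂ (λ u v → suc M * u + suc D * v) (compositions*!≡! (suc D) M) (compositions*!≡! D (suc M)) ⟩
  suc M * (suc D + M) ! + suc D * (D + suc M) !
    ≡⟨ cong (λ u → suc M * u ! + suc D * (D + suc M) !) (+-suc D M) ⟨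
  suc M * (D + suc M) ! + suc D * (D + suc M) !
    ≡⟨ collect M D ((D + suc M) !) ⟩
  suc (suc (D + M)) * (D + suc M) !
    ≡⟨ cong (λ u → suc u * (D + suc M) !) (+-suc D M) ⟨
  (suc D + suc M) !
    ∎
  where
  open ≡-Reasoning
  a = compositions (suc (suc D)) M
  b = compositions (suc D) (suc M)
  expand : ∀ a b D d M m → (a + b) * ((suc D * d) * (suc M * m))
         ≡ suc M * (a * ((suc D * d) * m)) + suc D * (b * (d * (suc M * m)))
  expand = solve-∀
  collect : ∀ M D T → suc M * T + suc D * T ≡ suc (suc (D + M)) * T
  collect = solve-∀

compositions-suc : ∀ D M → compositions (suc D) (suc M) * suc M ≡ compositions (suc D) M * (suc M + D)
compositions-suc D M = *-cancelʳ-≡ _ _ (D ! * M !) {{D !* M !≢0}} (begin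
  b * suc M * (D ! * M !)          ≡⟨ regroupˡ b M (D !) (M !) ⟩
  b * (D ! * suc M !)              ≡⟨ compositions*!≡! D (suc M) ⟩
  (D + suc M) !                    ≡⟨ cong _! (+-suc D M) ⟩
  suc (D + M) * (D + M) !          ≡⟨ cong (suc (D + M) *_) (compositions*!≡! D M) ⟨
  suc (D + M) * (a * (D ! * M !))  ≡⟨ regroupʳ D M a (D ! * M !) ⟩
  a * (suc M + D) * (D ! * M !)    ∎)
  where
  open ≡-Reasoning
  a = compositions (suc D) M
  b = compositions (suc D) (suc M)
  regroupˡ : ∀ b M d m → b * suc M * (d * m) ≡ b * (d * (suc M * m))
  regroupˡ = solve-∀
  regroupʳ : ∀ D M a K → suc (D + M) * (a * K) ≡ a * (suc M + D) * K
  regroupʳ = solve-∀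

compositions-step : ∀ {D M m} → suc M ≤ m →
                    compositions (suc D) M * (m + D) ≤ compositions (suc D) (suc M) * m
compositions-step {D} {M} {m} 1+M≤m = *-cancelʳ-≤ (a * (m + D)) (b * m) (suc M) (begin
  a * (m + D) * suc M           ≡⟨ expand a m D (suc M) ⟩
  a * (m * suc M + D * suc M)   ≤⟨ *-monoʳ-≤ a (+-monoʳ-≤ (m * suc M) (*-monoʳ-≤ D 1+M≤m)) ⟩
  a * (m * suc M + D * m)       ≡⟨ collect a m D (suc M) ⟩
  a * (suc M + D) * m           ≡⟨ cong (_* m) (compositions-suc D M) ⟨
  b * suc M * m                 ≡⟨ *-right-comm b (suc M) m ⟩
  b * m * suc M                 ∎)
  where
  open ≤-Reasoning
  a = compositions (suc D) M
  b = compositions (suc D) (suc M)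
  expand : ∀ a m D s → a * (m + D) * s ≡ a * (m * s + D * s)
  expand = solve-∀
  collect : ∀ a m D s → a * (m * s + D * m) ≡ a * (s + D) * m
  collect = solve-∀
  *-right-comm : ∀ a b c → a * b * c ≡ a * c * b
  *-right-comm = solve-∀

compositions-growth : ∀ {D m} K j → K + j ≤ m →
                      compositions (suc D) K * (m + D) ^ j ≤ compositions (suc D) (K + j) * m ^ j
compositions-growth {D} {m} K zero    _ rewrite +-identityʳ K = ≤-refl
compositions-growth {D} {m} K (suc j) K+j<m = begin
  c K * ((m + D) * (m + D) ^ j)   ≡⟨ x∙yz≈y∙xz (c K) (m + D) ((m + D) ^ j) ⟩
  (m + D) * (c K * (m + D) ^ j)   ≤⟨ *-monoʳ-≤ (m + D) (compositions-growth K j (≤-trans (+-monoʳ-≤ K (n≤1+n j)) K+j<m)) ⟩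
  (m + D) * (c (K + j) * m ^ j)   ≡⟨ x∙yz≈y∙xz (m + D) (c (K + j)) (m ^ j) ⟩
  c (K + j) * ((m + D) * m ^ j)   ≡⟨ *-assoc (c (K + j)) (m + D) (m ^ j) ⟨
  c (K + j) * (m + D) * m ^ j     ≤⟨ *-monoˡ-≤ (m ^ j) (compositions-step (subst (_≤ m) (+-suc K j) K+j<m)) ⟩
  c (suc (K + j)) * m * m ^ j     ≡⟨ cong (λ u → c u * m * m ^ j) (+-suc K j) ⟨
  c (K + suc j) * m * m ^ j       ≡⟨ *-assoc (c (K + suc j)) m (m ^ j) ⟩
  c (K + suc j) * (m * m ^ j)     ∎
  where
  open ≤-Reasoning
  c = compositions (suc D)

compositions-growth-scaled : ∀ {D m a b} K j → 0 < m → K + j ≤ m → a * m ^ j ≤ b * (m + D) ^ j →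
                             a * compositions (suc D) K ≤ b * compositions (suc D) (K + j)
compositions-growth-scaled {D} {m} {a} {b} K j m>0 K+j≤m amʲ≤b[m+D]ʲ =
  *-cancelʳ-≤ (a * c K) (b * c (K + j)) ((m + D) ^ j) {{m^n≢0 (m + D) j {{>-nonZero (≤-trans m>0 (m≤m+n m D))}}}} (begin
    a * c K * (m + D) ^ j       ≡⟨ *-assoc a (c K) ((m + D) ^ j) ⟩
    a * (c K * (m + D) ^ j)     ≤⟨ *-monoʳ-≤ a (compositions-growth K j K+j≤m) ⟩
    a * (c (K + j) * m ^ j)     ≡⟨ x∙yz≈y∙xz a (c (K + j)) (m ^ j) ⟩
    c (K + j) * (a * m ^ j)     ≤⟨ *-monoʳ-≤ (c (K + j)) amʲ≤b[m+D]ʲ ⟩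
    c (K + j) * (b * (m + D) ^ j) ≡⟨ x∙yz≈y∙xz (c (K + j)) b ((m + D) ^ j) ⟩
    b * (c (K + j) * (m + D) ^ j) ≡⟨ *-assoc b (c (K + j)) ((m + D) ^ j) ⟨
    b * c (K + j) * (m + D) ^ j ∎)
  where
  open ≤-Reasoning
  c = compositions (suc D)

-- Counting 𝒴₁ and 𝒴₃

sum≤length*bound : ∀ {k B} (v : Vec ℕ k) → (∀ i → lookup v i ≤ B) → sum v ≤ k * B
sum≤length*bound []      _        = z≤n
sum≤length*bound (x ∷ v) entry≤B = +-mono-≤ (entry≤B zero) (sum≤length*bound v (entry≤B ∘ suc))

↣⇒≤ : ∀ {a b} → Fin a ↣ Fin b → a ≤ b
↣⇒≤ f = Fin.injective⇒≤ (Injection.injective f)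

↔⇒≡ : ∀ {a b} → Fin a ↔ Fin b → a ≡ b
↔⇒≡ f = ≤-antisym (↣⇒≤ (↔⇒↣ f)) (↣⇒≤ (↔⇒↣ (↔-sym f)))

split-overflow : ∀ {L} ν (y : Vec ℕ L) → ¬ All (_< ν) y →
                 Σ (Fin L) λ i → Σ (Vec ℕ L) λ z → (sum z + ν ≡ sum y) × (updateAt z i (_+ ν) ≡ y)
split-overflow ν []      ¬small = contradiction [] ¬small
split-overflow ν (x ∷ y) ¬small with x <? ν
... | yes x<ν =
  let i , z , sum≡ , z↑≡y = split-overflow ν y (¬small ∘ (x<ν ∷_))
  in suc i , x ∷ z , trans (+-assoc x (sum z) ν) (cong (x +_) sum≡) , cong (x ∷_) z↑≡y
... | no  x≮ν = zero , x ∸ ν ∷ y , sum≡ , cong (_∷ y) (m∸n+n≡m ν≤x)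
  where
  ν≤x = ≮⇒≥ x≮ν
  sum≡ : x ∸ ν + sum y + ν ≡ x + sum y
  sum≡ = begin
    x ∸ ν + sum y + ν    ≡⟨ +-right-comm (x ∸ ν) (sum y) ν ⟩
    x ∸ ν + ν + sum y    ≡⟨ cong (_+ sum y) (m∸n+n≡m ν≤x) ⟩
    x + sum y            ∎
    where
    open ≡-Reasoning
    +-right-comm : ∀ a b c → a + b + c ≡ a + c + b
    +-right-comm = solve-∀

𝒴₁↔Compositions : ∀ {n ν m A} → A ≤ m → 𝒴₁ n ν m A ↔ Compositions (n ∸ ν) (m ∸ A)
𝒴₁↔Compositions {A = A} A≤m = mk↔ₛ′
  (λ (y , s) → y , trans (sym (m+n∸n≡m (sum y) A)) (cong (_∸ A) s))
  (λ (y , s) → y , trans (cong (_+ A) s) (m∸n+n≡m A≤m))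
  (λ _ → Compositions-≡ refl) (λ _ → Σ-≡ ≡-irrelevant refl)

𝒴₃↣𝒴₁ : ∀ {n ν m A} → 𝒴₃ n ν m A ↣ 𝒴₁ n ν m A
𝒴₃↣𝒴₁ {n} {ν} {m} {A} = mk↣ {to = forget} (Σ-≡ irrelevant ∘ cong proj₁)
  where
  forget : 𝒴₃ n ν m A → 𝒴₁ n ν m A
  forget (y , s , _) = y , s
  irrelevant : ∀ {y} (p q : (sum y + A ≡ m) × All (_< ν) y) → p ≡ q
  irrelevant (s , small) (s′ , small′) =
    cong₂ _,_ (≡-irrelevant s s′) (All.irrelevant <-irrelevant small small′)

𝒴₁↣𝒴₃⊎overflow : ∀ {n ν m A} →
  𝒴₁ n ν m A ↣ (𝒴₃ n ν m A ⊎ (Fin (n ∸ ν) × Compositions (n ∸ ν) (m ∸ A ∸ ν)))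
𝒴₁↣𝒴₃⊎overflow {n} {ν} {m} {A} = mk↣ {to = classify} λ {u} {v} eq →
  Σ-≡ ≡-irrelevant (trans (sym (restore∘classify u)) (trans (cong restore eq) (restore∘classify v)))
  where
  lowered-sum : ∀ {s t} → s + ν ≡ t → t + A ≡ m → s ≡ m ∸ A ∸ ν
  lowered-sum {s} {t} s+ν≡t t+A≡m = begin
    s                      ≡⟨ m+n∸n≡m s (A + ν) ⟨
    s + (A + ν) ∸ (A + ν)  ≡⟨ cong (_∸ (A + ν)) (rearrange s+ν≡t t+A≡m) ⟩
    m ∸ (A + ν)            ≡⟨ ∸-+-assoc m A ν ⟨
    m ∸ A ∸ ν              ∎
    where
    open ≡-Reasoning
    rearrange : s + ν ≡ t → t + A ≡ m → s + (A + ν) ≡ m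
    rearrange refl refl = trans (cong (s +_) (+-comm A ν)) (sym (+-assoc s ν A))
  classify : 𝒴₁ n ν m A → 𝒴₃ n ν m A ⊎ (Fin (n ∸ ν) × Compositions (n ∸ ν) (m ∸ A ∸ ν))
  classify (y , s) with all? (_<? ν) y
  ... | yes small = inj₁ (y , s , small)
  ... | no ¬small =
    let i , z , sum≡ , _ = split-overflow ν y ¬small in inj₂ (i , z , lowered-sum sum≡ s)
  restore : 𝒴₃ n ν m A ⊎ (Fin (n ∸ ν) × Compositions (n ∸ ν) (m ∸ A ∸ ν)) → Vec ℕ (n ∸ ν)
  restore (inj₁ (y , _))     = y
  restore (inj₂ (i , z , _)) = updateAt z i (_+ ν)
  restore∘classify : ∀ u → restore (classify u) ≡ proj₁ u
  restore∘classify (y , s) with all? (_<? ν) y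
  ... | yes _     = refl
  ... | no ¬small = let _ , _ , _ , z↑≡y = split-overflow ν y ¬small in z↑≡y

N₁≡compositions : ∀ {n ν m A N₁} → A ≤ m → Fin N₁ ↔ 𝒴₁ n ν m A →
                  N₁ ≡ compositions (n ∸ ν) (m ∸ A)
N₁≡compositions {n} {ν} {m} {A} A≤m Y₁ =
  ↔⇒≡ (Compositions↔Fin (n ∸ ν) (m ∸ A) ↔-∘ (𝒴₁↔Compositions {n} {ν} A≤m ↔-∘ Y₁))

N₃≤N₁ : ∀ {n ν m A N₁ N₃} → Fin N₁ ↔ 𝒴₁ n ν m A → Fin N₃ ↔ 𝒴₃ n ν m A → N₃ ≤ N₁
N₃≤N₁ Y₁ Y₃ = ↣⇒≤ (↔⇒↣ (↔-sym Y₁) ↣-∘ (𝒴₃↣𝒴₁ ↣-∘ ↔⇒↣ Y₃))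

N₁≤N₃+overflow : ∀ {n ν m A N₁ N₃} → Fin N₁ ↔ 𝒴₁ n ν m A → Fin N₃ ↔ 𝒴₃ n ν m A →
                 N₁ ≤ N₃ + (n ∸ ν) * compositions (n ∸ ν) (m ∸ A ∸ ν)
N₁≤N₃+overflow {n} {ν} {m} {A} Y₁ Y₃ = ↣⇒≤
  (↔⇒↣ (↔-sym Fin.+↔⊎) ↣-∘ ((↔⇒↣ (↔-sym Y₃) ⊎-↣ overflow↣Fin) ↣-∘ (𝒴₁↣𝒴₃⊎overflow ↣-∘ ↔⇒↣ Y₁)))
  where
  L = n ∸ ν
  K = m ∸ A ∸ ν
  overflow↣Fin : (Fin L × Compositions L K) ↣ Fin (L * compositions L K)
  overflow↣Fin = ↔⇒↣ (↔-sym Fin.*↔×) ↣-∘ (↣-id _ ×-↣ ↔⇒↣ (Compositions↔Fin L K))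

-- The asymptotic regime

power-of-two-between : ∀ n → 0 < n → Σ ℕ λ ℓ → n ≤ 2 ^ ℓ × 2 ^ ℓ ≤ 2 * n
power-of-two-between (suc zero)    _ = 0 , ≤-refl , s≤s z≤n
power-of-two-between (suc (suc n)) _ with power-of-two-between (suc n) (s≤s z≤n)
... | ℓ , 1+n≤2^ℓ , 2^ℓ≤2+2n with suc (suc n) ≤? 2 ^ ℓ
...   | yes 2+n≤2^ℓ = ℓ , 2+n≤2^ℓ , ≤-trans 2^ℓ≤2+2n (*-monoʳ-≤ 2 (n≤1+n (suc n)))
...   | no  2+n≰2^ℓ = suc ℓ , ≤-trans (m≤m+n (suc (suc n)) n) (≤-reflexive 2+n+n≡2^[1+ℓ])
                       , ≤-trans (≤-reflexive (cong (2 *_) 2^ℓ≡1+n)) (*-monoʳ-≤ 2 (n≤1+n (suc n)))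
  where
  2^ℓ≡1+n : 2 ^ ℓ ≡ suc n
  2^ℓ≡1+n = ≤-antisym (≤-pred (≰⇒> 2+n≰2^ℓ)) 1+n≤2^ℓ
  2+n+n≡2^[1+ℓ] : suc (suc n) + n ≡ 2 ^ suc ℓ
  2+n+n≡2^[1+ℓ] = trans (double n) (cong (2 *_) (sym 2^ℓ≡1+n))
    where
    double : ∀ n → suc (suc n) + n ≡ 2 * suc n
    double = solve-∀

[1+ℓ]^4≤2*ℓ^4 : ∀ ℓ → 6 ≤ ℓ → suc ℓ ^ 4 ≤ 2 * ℓ ^ 4
[1+ℓ]^4≤2*ℓ^4 ℓ 6≤ℓ = subst (λ k → suc k ^ 4 ≤ 2 * k ^ 4) (m+[n∸m]≡n 6≤ℓ)
  (subst (suc (6 + (ℓ ∸ 6)) ^ 4 ≤_) (expand (ℓ ∸ 6)) (m≤m+n _ _))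
  where
  expand : ∀ x → (7 + x) * ((7 + x) * ((7 + x) * ((7 + x) * 1)))
                 + (191 + 356 * x + 138 * (x * x) + 20 * (x * x * x) + x * x * x * x)
               ≡ 2 * ((6 + x) * ((6 + x) * ((6 + x) * ((6 + x) * 1))))
  expand = solve-∀

64*ℓ^4<2^ℓ : ∀ ℓ → 40 ≤ ℓ → 64 * ℓ ^ 4 < 2 ^ ℓ
64*ℓ^4<2^ℓ ℓ 40≤ℓ = subst (λ k → 64 * k ^ 4 < 2 ^ k) (m∸n+n≡m 40≤ℓ) (from-40 (ℓ ∸ 40))
  where
  from-40 : ∀ x → 64 * (x + 40) ^ 4 < 2 ^ (x + 40)
  from-40 zero    = m≤m+n (suc (64 * 40 ^ 4)) (2 ^ 40 ∸ suc (64 * 40 ^ 4))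
  from-40 (suc x) = begin-strict
    64 * suc (x + 40) ^ 4    ≤⟨ *-monoʳ-≤ 64 ([1+ℓ]^4≤2*ℓ^4 (x + 40) (≤-trans (m≤m+n 6 34) (m≤n+m 40 x))) ⟩
    64 * (2 * (x + 40) ^ 4)  ≡⟨ x∙yz≈y∙xz 64 2 ((x + 40) ^ 4) ⟩
    2 * (64 * (x + 40) ^ 4)  <⟨ *-monoʳ-< 2 (from-40 x) ⟩
    2 * 2 ^ (x + 40)         ∎
    where open ≤-Reasoning

record Regime (n m ν : ℕ) : Set where
  field
    ℓ W       : ℕ
    n≤2^ℓ     : n ≤ 2 ^ ℓ
    m≤ℓn      : m ≤ ℓ * n
    ν<W       : ν < W
    W*W≤m     : W * W ≤ m
    2W≤n      : 2 * W ≤ n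
    [2ℓ]²W≤n  : 2 * ℓ * (2 * ℓ * W) ≤ n

  2[1+ν]≤n : 2 * suc ν ≤ n
  2[1+ν]≤n = ≤-trans (*-monoʳ-≤ 2 ν<W) 2W≤n

  ν*[1+ν]≤m : ν * suc ν ≤ m
  ν*[1+ν]≤m = ≤-trans (*-mono-≤ (<⇒≤ ν<W) ν<W) W*W≤m

  m>0 : 0 < m
  m>0 = ≤-trans (*-mono-≤ (≤-trans (s≤s z≤n) ν<W) (≤-trans (s≤s z≤n) ν<W)) W*W≤m

-- ℓ ≈ log₂ n turns α ≤ log n into m ≤ ℓ n, and then ν ≈ 2 (α + 1) log n stays below
-- W = 2 ℓ (ℓ + 1) + 1; for n ≥ 2^40 the polynomial 2 (4 ℓ²) W ≤ 32 ℓ⁴ is still below n.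
regime : ∀ {n m ν} → 2 ^ 40 ≤ n → AlphaRange n m → ¬ N≤exp (n ^ (2 * (m + n))) (n * ν) →
         Regime n m (suc ν)
regime {n} {m} {ν} n-large (n^n≤e^2m , e^m≤n^n) ν-least = record
  { ℓ = ℓ ; W = W ; n≤2^ℓ = n≤2^ℓ ; m≤ℓn = m≤ℓn ; ν<W = s≤s ν<2ℓ[ℓ+1]
  ; W*W≤m    = *-cancelˡ-≤ 2 (≤-pred (≤-trans (≤-<-trans 2W*W≤2cW 2cW<n) n≤1+2m))
  ; 2W≤n     = ≤-trans (*-monoˡ-≤ W (*-monoʳ-≤ 2 (≤-trans (s≤s z≤n) W≤c))) (<⇒≤ 2cW<n)
  ; [2ℓ]²W≤n = ≤-trans (≤-reflexive (square ℓ W)) (≤-trans (*-monoˡ-≤ W (m≤n*m c 2)) (<⇒≤ 2cW<n))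
  }
  where
  n>0 : 0 < n
  n>0 = ≤-trans (m^n>0 2 40) n-large
  between = power-of-two-between n n>0
  ℓ = proj₁ between
  n≤2^ℓ : n ≤ 2 ^ ℓ
  n≤2^ℓ = proj₁ (proj₂ between)
  2^ℓ≤2n : 2 ^ ℓ ≤ 2 * n
  2^ℓ≤2n = proj₂ (proj₂ between)
  -- The implicit exponents must be given: otherwise 2 ^ 40 is unfolded while solving them.
  40≤ℓ : 40 ≤ ℓ
  40≤ℓ = ^-cancelˡ-≤ {2} {40} {ℓ} (s≤s (s≤s z≤n)) (≤-trans n-large n≤2^ℓ)
  m≤ℓn : m ≤ ℓ * n
  m≤ℓn = ^-cancelˡ-≤ (s≤s (s≤s z≤n)) (begin
    2 ^ m        ≤⟨ exp≤N⇒2^≤ e^m≤n^n ⟩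
    n ^ n        ≤⟨ ^-monoˡ-≤ n n≤2^ℓ ⟩
    (2 ^ ℓ) ^ n  ≡⟨ ^-*-assoc 2 ℓ n ⟩
    2 ^ (ℓ * n)  ∎)
    where open ≤-Reasoning
  n≤1+2m : n ≤ suc (2 * m)
  n≤1+2m = n^n≤k^k⇒n≤k (N≤exp⇒≤[1+p]^[1+p] n^n≤e^2m)
  ν<2ℓ[ℓ+1] : ν < 2 * ℓ * suc ℓ
  ν<2ℓ[ℓ+1] = *-cancelˡ-< n ν (2 * ℓ * suc ℓ) (begin-strict
    n * ν                  <⟨ ^-cancelˡ-< 2 (<-≤-trans (¬N≤exp⇒2^< ν-least) X≤2^[2ℓ[m+n]]) ⟩
    ℓ * (2 * (m + n))      ≤⟨ *-monoʳ-≤ ℓ (*-monoʳ-≤ 2 (+-monoˡ-≤ n m≤ℓn)) ⟩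
    ℓ * (2 * (ℓ * n + n))  ≡⟨ regroup ℓ n ⟩
    n * (2 * ℓ * suc ℓ)    ∎)
    where
    open ≤-Reasoning
    X≤2^[2ℓ[m+n]] : n ^ (2 * (m + n)) ≤ 2 ^ (ℓ * (2 * (m + n)))
    X≤2^[2ℓ[m+n]] = ≤-trans (^-monoˡ-≤ (2 * (m + n)) n≤2^ℓ) (≤-reflexive (^-*-assoc 2 ℓ (2 * (m + n))))
    regroup : ∀ ℓ n → ℓ * (2 * (ℓ * n + n)) ≡ n * (2 * ℓ * suc ℓ)
    regroup = solve-∀
  W = suc (2 * ℓ * suc ℓ)
  c = 4 * ℓ * ℓ
  W≤c : W ≤ c
  W≤c = subst (λ k → suc (2 * k * suc k) ≤ 4 * k * k) (m+[n∸m]≡n (≤-trans (s≤s (s≤s z≤n)) 40≤ℓ))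
          (subst (suc (2 * (2 + x) * suc (2 + x)) ≤_) (sym (expand x)) (m≤m+n _ _))
    where
    x = ℓ ∸ 2
    expand : ∀ x → 4 * (2 + x) * (2 + x) ≡ suc (2 * (2 + x) * suc (2 + x)) + (2 * (x * x) + 6 * x + 3)
    expand = solve-∀
  2cW<n : 2 * c * W < n
  2cW<n = *-cancelˡ-< 2 (2 * c * W) n (begin-strict
    2 * (2 * c * W)   ≤⟨ *-monoʳ-≤ 2 (*-monoʳ-≤ (2 * c) W≤c) ⟩
    2 * (2 * c * c)   ≡⟨ expand ℓ ⟩
    64 * ℓ ^ 4        <⟨ 64*ℓ^4<2^ℓ ℓ 40≤ℓ ⟩
    2 ^ ℓ             ≤⟨ 2^ℓ≤2n ⟩
    2 * n             ∎)
    where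
    open ≤-Reasoning
    expand : ∀ ℓ → 2 * (2 * (4 * ℓ * ℓ) * (4 * ℓ * ℓ)) ≡ 64 * (ℓ * (ℓ * (ℓ * (ℓ * 1))))
    expand = solve-∀
  2W*W≤2cW : 2 * (W * W) ≤ 2 * c * W
  2W*W≤2cW = ≤-trans (≤-reflexive (sym (*-assoc 2 W W))) (*-monoˡ-≤ W (*-monoʳ-≤ 2 W≤c))
  square : ∀ ℓ W → 2 * ℓ * (2 * ℓ * W) ≡ 4 * ℓ * ℓ * W
  square = solve-∀

-- With X = n^(2(m+n)) and j = m + n + e, N≤exp at k = ν j gives X m^(ν j) ≤ (m + D)^(ν j).
-- As (n² m^ν)^j = X n^(2e) m^(ν j) and n^(2e) ≤ 2^j, the claim follows by taking j-th roots.
n^2*m^ν≤2*[m+D]^ν : ∀ {n m ν D ℓ e} → n ≡ D + suc ν → 0 < ν → 0 < m → n ≤ 2 ^ ℓ →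
                    m * suc ν ≤ e * D → 2 * ℓ * e ≤ m + n →
                    N≤exp (n ^ (2 * (m + n))) (n * ν) → n ^ 2 * m ^ ν ≤ 2 * (m + D) ^ ν
n^2*m^ν≤2*[m+D]^ν {n} {m} {ν} {D} {ℓ} {e} n≡ ν>0 m>0 n≤2^ℓ m[1+ν]≤eD 2ℓe≤m+n X≤eⁿᵛ =
  ^-cancelʳ-≤ j {{>-nonZero j>0}} (begin
    (n ^ 2 * m ^ ν) ^ j                              ≡⟨ ^-distribʳ-* (n ^ 2) (m ^ ν) j ⟩
    (n ^ 2) ^ j * (m ^ ν) ^ j                        ≡⟨ cong₂ _*_ (^-distribˡ-+-* (n ^ 2) (m + n) e) (^-*-assoc m ν j) ⟩
    (n ^ 2) ^ (m + n) * (n ^ 2) ^ e * m ^ (ν * j)    ≡⟨ cong (λ u → u * (n ^ 2) ^ e * m ^ (ν * j)) (^-*-assoc n 2 (m + n)) ⟩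
    X * (n ^ 2) ^ e * m ^ (ν * j)                    ≡⟨ *-right-comm X ((n ^ 2) ^ e) (m ^ (ν * j)) ⟩
    X * m ^ (ν * j) * (n ^ 2) ^ e                    ≤⟨ *-mono-≤ scaled n^2e≤2^j ⟩
    P ^ (ν * j) * 2 ^ j                              ≡⟨ cong (_* 2 ^ j) (^-*-assoc P ν j) ⟨
    (P ^ ν) ^ j * 2 ^ j                              ≡⟨ *-comm ((P ^ ν) ^ j) (2 ^ j) ⟩
    2 ^ j * (P ^ ν) ^ j                              ≡⟨ ^-distribʳ-* 2 (P ^ ν) j ⟨
    (2 * P ^ ν) ^ j                                  ∎)
  where
  open ≤-Reasoning
  X = n ^ (2 * (m + n))
  P = m + D
  j = m + n + e
  j>0 : 0 < j
  j>0 = ≤-trans m>0 (≤-trans (m≤m+n m n) (m≤m+n (m + n) e))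
  q = ν * (m + e)
  scaled : X * m ^ (ν * j) ≤ P ^ (ν * j)
  scaled = subst (λ k → X * m ^ k ≤ P ^ k) (split n m ν e)
             (N≤exp-scale {X = X} X≤eⁿᵛ (*-mono-≤ ν>0 (≤-trans m>0 (m≤m+n m e))) (begin
               (n * ν + q) * m         ≡⟨ factor n m ν e ⟩
               ν * ((n + m + e) * m)   ≤⟨ *-monoʳ-≤ ν [n+m+e]m≤[m+e]P ⟩
               ν * ((m + e) * P)       ≡⟨ *-assoc ν (m + e) P ⟨
               q * P                   ∎))
    where
    split : ∀ n m ν e → n * ν + ν * (m + e) ≡ ν * (m + n + e)
    split = solve-∀
    factor : ∀ n m ν e → (n * ν + ν * (m + e)) * m ≡ ν * ((n + m + e) * m)
    factor = solve-∀
    [n+m+e]m≤[m+e]P : (n + m + e) * m ≤ (m + e) * P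
    [n+m+e]m≤[m+e]P = begin
      (n + m + e) * m                          ≡⟨ cong (λ u → (u + m + e) * m) n≡ ⟩
      (D + suc ν + m + e) * m                  ≡⟨ expand D ν m e ⟩
      m * suc ν + (D * m + m * m + e * m)      ≤⟨ +-monoˡ-≤ _ m[1+ν]≤eD ⟩
      e * D + (D * m + m * m + e * m)          ≡⟨ collect D m e ⟩
      (m + e) * (m + D)                        ∎
      where
      expand : ∀ D ν m e → (D + suc ν + m + e) * m ≡ m * suc ν + (D * m + m * m + e * m)
      expand = solve-∀
      collect : ∀ D m e → e * D + (D * m + m * m + e * m) ≡ (m + e) * (m + D)
      collect = solve-∀
  n^2e≤2^j : (n ^ 2) ^ e ≤ 2 ^ j
  n^2e≤2^j = begin
    (n ^ 2) ^ e         ≡⟨ ^-*-assoc n 2 e ⟩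
    n ^ (2 * e)         ≤⟨ ^-monoˡ-≤ (2 * e) n≤2^ℓ ⟩
    (2 ^ ℓ) ^ (2 * e)   ≡⟨ ^-*-assoc 2 ℓ (2 * e) ⟩
    2 ^ (ℓ * (2 * e))   ≤⟨ ^-monoʳ-≤ 2 (≤-trans (≤-reflexive (regroup ℓ e)) (≤-trans 2ℓe≤m+n (m≤m+n (m + n) e))) ⟩
    2 ^ j               ∎
    where
    regroup : ∀ ℓ e → ℓ * (2 * e) ≡ 2 * ℓ * e
    regroup = solve-∀
  *-right-comm : ∀ a b c → a * b * c ≡ a * c * b
  *-right-comm = solve-∀

Regime⇒n^2*m^ν≤2*[m+D]^ν : ∀ {n m ν} → Regime n m ν → 0 < ν → N≤exp (n ^ (2 * (m + n))) (n * ν) →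
                           n ^ 2 * m ^ ν ≤ 2 * (m + (n ∸ suc ν)) ^ ν
Regime⇒n^2*m^ν≤2*[m+D]^ν {n} {m} {ν} R ν>0 X≤eⁿᵛ =
  n^2*m^ν≤2*[m+D]^ν {ℓ = ℓ} {e = 2 * ℓ * W} n≡D+1+ν ν>0 m>0 n≤2^ℓ m[1+ν]≤eD
    (≤-trans [2ℓ]²W≤n (m≤n+m n m)) X≤eⁿᵛ
  where
  open Regime R
  D = n ∸ suc ν
  n≡D+1+ν : n ≡ D + suc ν
  n≡D+1+ν = sym (m∸n+n≡m (≤-trans (m≤n*m (suc ν) 2) 2[1+ν]≤n))
  n≤2D : n ≤ 2 * D
  n≤2D = begin
    n          ≡⟨ n≡D+1+ν ⟩
    D + suc ν  ≤⟨ +-monoʳ-≤ D 1+ν≤D ⟩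
    D + D      ≡⟨ cong (D +_) (+-identityʳ D) ⟨
    2 * D      ∎
    where
    open ≤-Reasoning
    1+ν≤D : suc ν ≤ D
    1+ν≤D = +-cancelʳ-≤ (suc ν) (suc ν) D (begin
      suc ν + suc ν  ≡⟨ cong (suc ν +_) (+-identityʳ (suc ν)) ⟨
      2 * suc ν      ≤⟨ 2[1+ν]≤n ⟩
      n              ≡⟨ n≡D+1+ν ⟩
      D + suc ν      ∎)
  m[1+ν]≤eD : m * suc ν ≤ 2 * ℓ * W * D
  m[1+ν]≤eD = begin
    m * suc ν          ≤⟨ *-mono-≤ m≤ℓn ν<W ⟩
    ℓ * n * W          ≤⟨ *-monoˡ-≤ W (*-monoʳ-≤ ℓ n≤2D) ⟩
    ℓ * (2 * D) * W    ≡⟨ regroup ℓ D W ⟩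
    2 * ℓ * W * D      ∎
    where
    open ≤-Reasoning
    regroup : ∀ ℓ D W → ℓ * (2 * D) * W ≡ 2 * ℓ * W * D
    regroup = solve-∀

overflow⇒n*∣N₁-N₃∣≤C*N₁ : ∀ {n L F N₁ N₃ C} → N₃ ≤ N₁ → N₁ ≤ N₃ + L * F → L ≤ n →
                          n ^ 2 * F ≤ C * N₁ → n * ∣ N₁ - N₃ ∣ ≤ C * N₁
overflow⇒n*∣N₁-N₃∣≤C*N₁ {n} {L} {F} {N₁} {N₃} {C} N₃≤N₁ N₁≤N₃+LF L≤n n²F≤CN₁ = begin
  n * ∣ N₁ - N₃ ∣   ≡⟨ cong (n *_) (m≤n⇒∣n-m∣≡n∸m N₃≤N₁) ⟩
  n * (N₁ ∸ N₃)     ≤⟨ *-monoʳ-≤ n (subst (N₁ ∸ N₃ ≤_) (m+n∸m≡n N₃ (L * F)) (∸-monoˡ-≤ N₃ N₁≤N₃+LF)) ⟩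
  n * (L * F)       ≤⟨ *-monoʳ-≤ n (*-monoˡ-≤ F L≤n) ⟩
  n * (n * F)       ≡⟨ *-assoc n n F ⟨
  n * n * F         ≡⟨ cong (λ u → n * u * F) (*-identityʳ n) ⟨
  n ^ 2 * F         ≤⟨ n²F≤CN₁ ⟩
  C * N₁            ∎
  where open ≤-Reasoning

n*∣N₁-N₃∣≤2*N₁ : ∀ (n m ν : ℕ) → 2 ^ 40 ≤ n → AlphaRange n m → IsNu n m ν →
    (a : Vec ℕ ν) → (∀ (i : Fin ν) → lookup a i ≤ toℕ i) →
    ∀ (N₁ N₃ : ℕ) → (Fin N₁ ↔ 𝒴₁ n ν m (sum a)) → (Fin N₃ ↔ 𝒴₃ n ν m (sum a)) →
    (0 < N₁) × (n * ∣ N₁ - N₃ ∣ ≤ 2 * N₁)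
n*∣N₁-N₃∣≤2*N₁ n m zero n-large _ X≤e⁰ _ _ _ _ _ _ =
  contradiction (N≤exp⇒≤[1+p]^[1+p] X≤e⁰) (<⇒≱ (^-monoʳ-< n 1<n 0<2[m+n]))
  where
  1<n : 1 < n
  1<n = ≤-trans (^-monoʳ-≤ 2 {1} {40} (s≤s z≤n)) n-large
  0<2[m+n] : 0 < 2 * (m + n)
  0<2[m+n] = ≤-trans (<⇒≤ 1<n) (≤-trans (m≤n+m n m) (m≤m+n (m + n) (m + n + 0)))
n*∣N₁-N₃∣≤2*N₁ n m ν@(suc _) n-large αr (X≤eⁿᵛ , ν-least) a a≤i N₁ N₃ Y₁ Y₃ =
  subst (0 <_) (sym N₁≡) (compositions>0 D M) ,
  overflow⇒n*∣N₁-N₃∣≤C*N₁ {C = 2} (N₃≤N₁ {n} {ν} Y₁ Y₃) (N₁≤N₃+overflow {n} {ν} Y₁ Y₃) (m∸n≤m n ν) growth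
  where
  R : Regime n m ν
  R = regime {n} {m} n-large αr ν-least
  open Regime R
  A = sum a
  M = m ∸ A
  D = n ∸ suc ν
  n∸ν≡1+D : n ∸ ν ≡ suc D
  n∸ν≡1+D = m∸n≡1+[m∸1+n] (≤-trans (m≤n*m (suc ν) 2) 2[1+ν]≤n)
  A+ν≤m : A + ν ≤ m
  A+ν≤m = begin
    A + ν        ≤⟨ +-monoˡ-≤ ν (sum≤length*bound a (λ i → ≤-trans (a≤i i) (<⇒≤ (Fin.toℕ<n i)))) ⟩
    ν * ν + ν    ≡⟨ trans (+-comm (ν * ν) ν) (sym (*-suc ν ν)) ⟩
    ν * suc ν    ≤⟨ ν*[1+ν]≤m ⟩
    m            ∎
    where open ≤-Reasoning
  ν≤M : ν ≤ M
  ν≤M = subst (_≤ M) (m+n∸m≡n A ν) (∸-monoˡ-≤ A A+ν≤m)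
  N₁≡ : N₁ ≡ compositions (suc D) M
  N₁≡ = trans (N₁≡compositions {n} {ν} (≤-trans (m≤m+n A ν) A+ν≤m) Y₁) (cong (λ L → compositions L M) n∸ν≡1+D)
  growth : n ^ 2 * compositions (n ∸ ν) (M ∸ ν) ≤ 2 * N₁
  growth = subst₂ (λ L N → n ^ 2 * compositions L (M ∸ ν) ≤ 2 * N) (sym n∸ν≡1+D) (sym N₁≡)
    (subst (λ k → n ^ 2 * compositions (suc D) (M ∸ ν) ≤ 2 * compositions (suc D) k) (m∸n+n≡m ν≤M)
      (compositions-growth-scaled {a = n ^ 2} {b = 2} (M ∸ ν) ν m>0 M∸ν+ν≤m
        (Regime⇒n^2*m^ν≤2*[m+D]^ν R (s≤s z≤n) X≤eⁿᵛ)))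
    where
    M∸ν+ν≤m : M ∸ ν + ν ≤ m
    M∸ν+ν≤m = subst (_≤ m) (sym (m∸n+n≡m ν≤M)) (m∸n≤m m A)

lemma3p4 : Σ ℕ λ C → Σ ℕ λ N₀ →
    ∀ (n m ν : ℕ) → N₀ ≤ n → AlphaRange n m → IsNu n m ν →
    (a : Vec ℕ ν) → (∀ (i : Fin ν) → lookup a i ≤ toℕ i) →
    ∀ (N₁ N₃ : ℕ) → (Fin N₁ ↔ 𝒴₁ n ν m (sum a)) → (Fin N₃ ↔ 𝒴₃ n ν m (sum a)) →
    (0 < N₁) × (n * ∣ N₁ - N₃ ∣ ≤ C * N₁)
lemma3p4 = 2 , 2 ^ 40 , n*∣N₁-N₃∣≤2*N₁
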